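{- Let $\mathcal I$ be any adversarial instance and $\sigma$ any arrival sequence. Then $\frac{\mathbb E[\mathrm{GREEDY\text{ - }D}(\mathcal I,\sigma)]}{\mathrm{OFF\text{ - }I}(\mathcal I)}\ge\frac{1}{1+\kappa}$ if $\mathcal I$ is $\kappa$-oversupplied, and $\ge\frac{\kappa}{1+\kappa}$ if $\mathcal I$ is $\kappa$-undersupplied.
   Context: Adversarial online matching with stochastic rewards. An instance $\mathcal I$ consists of a finite set $S$ of supply nodes, demand nodes $t\in[T]$, an edge set $E\subseteq S\times[T]$ with every $t$ having a neighbor, and a common consumption probability $\mu\in(0,1]$; $N(t)=\{u:(u,t)\in E\}$. Demand nodes arrive one per period in order $\sigma$; on arrival of $t$ the algorithm sees $N(t)$ and irrevocably matches $t$ to some $u\in N(t)$ or leaves it unmatched; if matched to $u$, independently with probability $\mu$ $u$ is consumed, provided it was not consumed earlier. The value is the number of consumed supply nodes; $\mathbb E[\cdot]$ is its expectation. $\mathrm{GREEDY\text{ - }D}$: maintain counters $n_u=0$ for $u\in S$; when $t$ arrives, choose $u^*\in\arg\min_{u\in N(t)}n_u$ (ties broken arbitrarily), match $t$ to $u^*$, and increment $n_{u^*}$ (it never uses consumption outcomes). $\mathrm{OFF\text{ - }I}(\mathcal I,\kappa)$: optimal value of maximize $\sum_{(u,t)\in E}\mu x_{u,t}$ s.t. $\sum_{t:(u,t)\in E}\mu x_{u,t}\le\kappa$ ($u\in S$), $\sum_{u:(u,t)\in E}x_{u,t}\le1$ ($t\in[T]$), $x\ge0$; $\mathrm{OFF\text{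 - }I}(\mathcal I)=\mathrm{OFF\text{ - }I}(\mathcal I,1)$. $\mathcal I$ is $\kappa$-undersupplied if $\kappa=\max\{\bar\kappa\ge1:\mathrm{OFF\text{ - }I}(\mathcal I,\bar\kappa)=\bar\kappa\,\mathrm{OFF\text{ - }I}(\mathcal I)\}$ and $\kappa$-oversupplied if $\kappa=\min\{\bar\kappa\le1:\mathrm{OFF\text{ - }I}(\mathcal I,\bar\kappa)=\mathrm{OFF\text{ - }I}(\mathcal I)\}$ (extrema assumed attained at rationals). -}

module Defs where

open import Data.Nat as ℕ using (ℕ; zero; suc; _<ᵇ_)
open import Data.Fin using (Fin; zero; suc; toℕ; _≟_)
open import Data.Bool using (Bool; true; false; if_then_else_; _∧_; _∨_)
open import Data.Rational using (ℚ; 0ℚ; 1ℚ; _+_; _*_; _-_; _≤_; _<_)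
open import Data.Product using (_×_; Σ; ∃; _,_)
open import Relation.Binary.PropositionalEquality using (_≡_)
open import Relation.Nullary.Decidable using (⌊_⌋)
open import Function.Definitions using (Bijective)

sumℚ : (n : ℕ) → (Fin n → ℚ) → ℚ
sumℚ zero    f = 0ℚ
sumℚ (suc n) f = f zero + sumℚ n (λ i → f (suc i))

sumℕ : (n : ℕ) → (Fin n → ℕ) → ℕ
sumℕ zero    f = 0
sumℕ (suc n) f = f zero ℕ.+ sumℕ n (λ i → f (suc i))

anyFin : (n : ℕ) → (Fin n → Bool) → Bool
anyFin zero    f = false
anyFin (suc n) f = f zero ∨ anyFin n (λ i → f (suc i))

consB : {n : ℕ} → Bool → (Fin n → Bool) → Fin (suc n) → Bool
consB b ω zero    = b
consB b ω (suc i) = ω i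

-- Expectation of F over n independent Bernoulli(μ) coins ω : Fin n → Bool
-- (product measure: P(ω) = Π_i (μ if ω i else 1 - μ)).
expect : ℚ → (n : ℕ) → ((Fin n → Bool) → ℚ) → ℚ
expect μ zero    F = F (λ ())
expect μ (suc n) F =
  μ * expect μ n (λ ω → F (consB true ω))
  + (1ℚ - μ) * expect μ n (λ ω → F (consB false ω))

-- An instance: supply nodes S = Fin m, demand nodes [T] = Fin T,
-- edge set E given by its indicator, common consumption probability μ ∈ (0,1].
record Instance : Set where
  field
    m      : ℕ
    T      : ℕ
    edge   : Fin m → Fin T → Bool
    μ      : ℚ
    μ-pos  : 0ℚ < μ
    μ-le1  : μ ≤ 1ℚ
    hasNbr : ∀ (t : Fin T) → ∃ λ (u : Fin m) → edge u t ≡ true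

module _ (I : Instance) where
  open Instance I

  -- Arrival sequence σ: period k ∈ Fin T sees demand node σ k (σ a bijection).
  ArrivalSeq : (Fin T → Fin T) → Set
  ArrivalSeq σ = Bijective _≡_ _≡_ σ

  -- n_u just before period k, for assignment a (demand node ↦ supply node)
  counter : (Fin T → Fin T) → (Fin T → Fin m) → Fin T → Fin m → ℕ
  counter σ a k u =
    sumℕ T (λ j → if (toℕ j <ᵇ toℕ k) ∧ ⌊ a (σ j) ≟ u ⌋ then 1 else 0)

  -- a is a possible run of GREEDY-D on (I, σ) (for some arbitrary tie-breaking):
  -- at every period k, σ k is matched to a neighbour of minimal counter.
  GreedyDRun : (Fin T → Fin T) → (Fin T → Fin m) → Set
  GreedyDRun σ a = ∀ (k : Fin T) →
    (edge (a (σ k)) (σ k) ≡ true)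
    × (∀ (u : Fin m) → edge u (σ k) ≡ true →
         counter σ a k (a (σ k)) ℕ.≤ counter σ a k u)

  -- number of consumed supply nodes, given the coin outcomes ω (ω t = true
  -- iff the match of demand node t succeeds with its probability μ)
  consumed : (Fin T → Fin m) → (Fin T → Bool) → ℚ
  consumed a ω =
    sumℚ m (λ u → if anyFin T (λ t → ⌊ a t ≟ u ⌋ ∧ ω t) then 1ℚ else 0ℚ)

  expectedValue : (Fin T → Fin m) → ℚ
  expectedValue a = expect μ T (consumed a)

  LPFeasible : ℚ → (Fin m → Fin T → ℚ) → Set
  LPFeasible κ x =
    (∀ u t → 0ℚ ≤ x u t)
    × (∀ u → sumℚ T (λ t → if edge u t then μ * x u t else 0ℚ) ≤ κ)
    × (∀ t → sumℚ m (λ u → if edge u t then x u t else 0ℚ) ≤ 1ℚ)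

  LPObj : (Fin m → Fin T → ℚ) → ℚ
  LPObj x = sumℚ m (λ u → sumℚ T (λ t → if edge u t then μ * x u t else 0ℚ))

  IsOFF-I : ℚ → ℚ → Set
  IsOFF-I κ v =
    (∃ λ x → LPFeasible κ x × LPObj x ≡ v)
    × (∀ x → LPFeasible κ x → LPObj x ≤ v)

  OFFEqual : ℚ → Set
  OFFEqual κ̄ = ∃ λ v → IsOFF-I 1ℚ v × IsOFF-I κ̄ v

  Oversupplied : ℚ → Set
  Oversupplied κ =
    κ ≤ 1ℚ × OFFEqual κ × (∀ κ̄ → κ̄ ≤ 1ℚ → OFFEqual κ̄ → κ ≤ κ̄)

  OFFScales : ℚ → Set
  OFFScales κ̄ = ∃ λ v → IsOFF-I 1ℚ v × IsOFF-I κ̄ (κ̄ * v)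

  Undersupplied : ℚ → Set
  Undersupplied κ =
    1ℚ ≤ κ × OFFScales κ × (∀ κ̄ → 1ℚ ≤ κ̄ → OFFScales κ̄ → κ̄ ≤ κ)

-- A supply node matched c times is consumed with probability 1 - (1-μ)^c, so with
-- s_u = (1-μ)^(n_u) for the final counters, E[GREEDY-D] = Σ_u (1 - s_u); telescoping over
-- the periods also gives E[GREEDY-D] = Σ_k μ p_k, where p_k is the survival probability
-- of the node matched in period k. For a feasible solution x of OFF-I(I,κ) split the
-- objective as Σ_u s_u·load_u + Σ_u (1 - s_u)·load_u. Since load_u ≤ κ, the second part is
-- at most κ·E. Greedy matched σ k to a neighbour of least counter, so s_u ≤ p_k for every
-- neighbour u of σ k, and the demand constraint of σ k bounds the first part by Σ_k μ p_k = E.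
-- Hence OFF-I(I,κ) ≤ (1+κ)·E, and both cases follow from OFF-I(I,κ) = OFF-I(I),
-- respectively OFF-I(I,κ) = κ·OFF-I(I).
module Submission where

open import Defs
open import Algebra.Bundles using (Ring)
open import Data.Nat as ℕ using (ℕ; zero; suc; _<ᵇ_)
import Data.Nat.Properties as ℕP
open import Data.Fin using (Fin; zero; suc; toℕ; _≟_)
open import Data.Bool using (Bool; true; false; if_then_else_; _∧_)
open import Data.Rational using (ℚ; 0ℚ; 1ℚ; _+_; _*_; _-_; -_; _≤_; nonNegative; +-*-rawSemiring)
open import Data.Rational.Solver using (module +-*-Solver)
open import Algebra.Definitions.RawSemiring +-*-rawSemiring using (_^_)
import Data.Rational.Properties as ℚP
open import Data.Fin.Permutation using (Permutation; permutation)
open import Data.Product using (_×_; proj₁; proj₂; _,_)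
open import Function.Definitions using (Bijective)
open import Relation.Binary.PropositionalEquality
  using (_≡_; refl; sym; trans; cong; cong₂; subst; module ≡-Reasoning)
open import Relation.Nullary.Decidable using (⌊_⌋; ⌊⌋-map′)
open import Data.Fin.Properties using (suc-injective)
import Algebra.Properties.Semiring.Sum as SemiringSum
import Algebra.Properties.CommutativeMonoid.Sum as CommutativeMonoidSum

module Σℚ = SemiringSum (Ring.semiring ℚP.+-*-ring)
module Σℕ = CommutativeMonoidSum ℕP.+-0-commutativeMonoid

sumℚ≡sum : ∀ n (f : Fin n → ℚ) → sumℚ n f ≡ Σℚ.sum f
sumℚ≡sum zero    f = refl
sumℚ≡sum (suc n) f = cong (f zero +_) (sumℚ≡sum n (λ i → f (suc i)))

sumℕ≡sum : ∀ n (f : Fin n → ℕ) → sumℕ n f ≡ Σℕ.sum f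
sumℕ≡sum zero    f = refl
sumℕ≡sum (suc n) f = cong (f zero ℕ.+_) (sumℕ≡sum n (λ i → f (suc i)))

bijective⇒permutation : ∀ {n} {σ : Fin n → Fin n} → Bijective _≡_ _≡_ σ → Permutation n n
bijective⇒permutation {σ = σ} (injective , surjective) =
  permutation σ (λ y → proj₁ (surjective y))
    (λ y → proj₂ (surjective y) refl) (λ x → injective (proj₂ (surjective (σ x)) refl))

sumℚ-cong : ∀ n {f g : Fin n → ℚ} → (∀ i → f i ≡ g i) → sumℚ n f ≡ sumℚ n g
sumℚ-cong zero    f≗g = refl
sumℚ-cong (suc n) f≗g = cong₂ _+_ (f≗g zero) (sumℚ-cong n (λ i → f≗g (suc i)))

sumℚ-distrib-+ : ∀ n (f g : Fin n → ℚ) → sumℚ n (λ i → f i + g i) ≡ sumℚ n f + sumℚ n g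
sumℚ-distrib-+ n f g
  rewrite sumℚ≡sum n (λ i → f i + g i) | sumℚ≡sum n f | sumℚ≡sum n g = Σℚ.∑-distrib-+ f g

*-distribˡ-sumℚ : ∀ n c (f : Fin n → ℚ) → c * sumℚ n f ≡ sumℚ n (λ i → c * f i)
*-distribˡ-sumℚ n c f rewrite sumℚ≡sum n f | sumℚ≡sum n (λ i → c * f i) = Σℚ.*-distribˡ-sum c f

sumℚ-comm : ∀ m n (f : Fin m → Fin n → ℚ) →
  sumℚ m (λ i → sumℚ n (f i)) ≡ sumℚ n (λ j → sumℚ m (λ i → f i j))
sumℚ-comm m n f = begin
  sumℚ m (λ i → sumℚ n (f i))             ≡⟨ sumℚ-cong m (λ i → sumℚ≡sum n (f i)) ⟩
  sumℚ m (λ i → Σℚ.sum (f i))             ≡⟨ sumℚ≡sum m _ ⟩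
  Σℚ.sum (λ i → Σℚ.sum (f i))             ≡⟨ Σℚ.∑-comm f ⟩
  Σℚ.sum (λ j → Σℚ.sum (λ i → f i j))     ≡˘⟨ sumℚ≡sum n _ ⟩
  sumℚ n (λ j → Σℚ.sum (λ i → f i j))     ≡˘⟨ sumℚ-cong n (λ j → sumℚ≡sum m (λ i → f i j)) ⟩
  sumℚ n (λ j → sumℚ m (λ i → f i j))     ∎
  where open ≡-Reasoning

sumℚ-permute : ∀ n {σ : Fin n → Fin n} → Bijective _≡_ _≡_ σ → (f : Fin n → ℚ) →
  sumℚ n f ≡ sumℚ n (λ i → f (σ i))
sumℚ-permute n {σ} σ-bij f rewrite sumℚ≡sum n f | sumℚ≡sum n (λ i → f (σ i)) =
  Σℚ.∑-permute f (bijective⇒permutation σ-bij)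

sumℚ-zero : ∀ n → sumℚ n (λ _ → 0ℚ) ≡ 0ℚ
sumℚ-zero n rewrite sumℚ≡sum n (λ _ → 0ℚ) = Σℚ.sum-replicate-zero n

⌊suc≟suc⌋ : ∀ {n} (j k : Fin n) → ⌊ suc j ≟ suc k ⌋ ≡ ⌊ j ≟ k ⌋
⌊suc≟suc⌋ j k = ⌊⌋-map′ (cong suc) suc-injective (j ≟ k)

sumℚ-δ : ∀ n (k : Fin n) (f : Fin n → ℚ) → sumℚ n (λ j → if ⌊ k ≟ j ⌋ then f j else 0ℚ) ≡ f k
sumℚ-δ (suc n) zero    f = trans (cong (f zero +_) (sumℚ-zero n)) (ℚP.+-identityʳ (f zero))
sumℚ-δ (suc n) (suc k) f = trans (ℚP.+-identityˡ _) (trans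
  (sumℚ-cong n (λ j → cong (if_then f (suc j) else 0ℚ) (⌊suc≟suc⌋ k j)))
  (sumℚ-δ n k (λ j → f (suc j))))

sumℚ-mono-≤ : ∀ n {f g : Fin n → ℚ} → (∀ i → f i ≤ g i) → sumℚ n f ≤ sumℚ n g
sumℚ-mono-≤ zero    f≤g = ℚP.≤-refl
sumℚ-mono-≤ (suc n) f≤g = ℚP.+-mono-≤ (f≤g zero) (sumℚ-mono-≤ n (λ i → f≤g (suc i)))

sumℕ-cong : ∀ n {f g : Fin n → ℕ} → (∀ i → f i ≡ g i) → sumℕ n f ≡ sumℕ n g
sumℕ-cong zero    f≗g = refl
sumℕ-cong (suc n) f≗g = cong₂ ℕ._+_ (f≗g zero) (sumℕ-cong n (λ i → f≗g (suc i)))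

sumℕ-zero : ∀ n → sumℕ n (λ _ → 0) ≡ 0
sumℕ-zero zero    = refl
sumℕ-zero (suc n) = sumℕ-zero n

sumℕ-distrib-+ : ∀ n (f g : Fin n → ℕ) → sumℕ n (λ i → f i ℕ.+ g i) ≡ sumℕ n f ℕ.+ sumℕ n g
sumℕ-distrib-+ n f g
  rewrite sumℕ≡sum n (λ i → f i ℕ.+ g i) | sumℕ≡sum n f | sumℕ≡sum n g = Σℕ.∑-distrib-+ f g

sumℕ-permute : ∀ n {σ : Fin n → Fin n} → Bijective _≡_ _≡_ σ → (f : Fin n → ℕ) →
  sumℕ n f ≡ sumℕ n (λ i → f (σ i))
sumℕ-permute n {σ} σ-bij f rewrite sumℕ≡sum n f | sumℕ≡sum n (λ i → f (σ i)) =
  Σℕ.∑-permute f (bijective⇒permutation σ-bij)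

sumℕ-mono-≤ : ∀ n {f g : Fin n → ℕ} → (∀ i → f i ℕ.≤ g i) → sumℕ n f ℕ.≤ sumℕ n g
sumℕ-mono-≤ zero    f≤g = ℕ.z≤n
sumℕ-mono-≤ (suc n) f≤g = ℕP.+-mono-≤ (f≤g zero) (sumℕ-mono-≤ n (λ i → f≤g (suc i)))

sumℕ-δ : ∀ n (k : Fin n) (f : Fin n → ℕ) → sumℕ n (λ j → if ⌊ k ≟ j ⌋ then f j else 0) ≡ f k
sumℕ-δ (suc n) zero    f = trans (cong (f zero ℕ.+_) (sumℕ-zero n)) (ℕP.+-identityʳ (f zero))
sumℕ-δ (suc n) (suc k) f = trans
  (sumℕ-cong n (λ j → cong (if_then f (suc j) else 0) (⌊suc≟suc⌋ k j)))
  (sumℕ-δ n k (λ j → f (suc j)))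

module BernoulliExpectation (μ : ℚ) where
  open +-*-Solver

  mixture-of-equal : ∀ c → μ * c + (1ℚ - μ) * c ≡ c
  mixture-of-equal = solve 2 (λ μ c → μ :* c :+ (con 1ℚ :- μ) :* c := c) refl μ

  expect-const : ∀ n c → expect μ n (λ _ → c) ≡ c
  expect-const zero    c = refl
  expect-const (suc n) c rewrite expect-const n c = mixture-of-equal c

  expect-+ : ∀ n (F G : (Fin n → Bool) → ℚ) →
    expect μ n (λ ω → F ω + G ω) ≡ expect μ n F + expect μ n G
  expect-+ zero    F G = refl
  expect-+ (suc n) F G
    rewrite expect-+ n (λ ω → F (consB true ω)) (λ ω → G (consB true ω))
          | expect-+ n (λ ω → F (consB false ω)) (λ ω → G (consB false ω)) =
    solve 5 (λ μ a b c d → μ :* (a :+ b) :+ (con 1ℚ :- μ) :* (c :+ d)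
                         := (μ :* a :+ (con 1ℚ :- μ) :* c) :+ (μ :* b :+ (con 1ℚ :- μ) :* d))
      refl μ _ _ _ _

  expect-sumℚ : ∀ n m (F : Fin m → (Fin n → Bool) → ℚ) →
    expect μ n (λ ω → sumℚ m (λ u → F u ω)) ≡ sumℚ m (λ u → expect μ n (F u))
  expect-sumℚ n zero    F = expect-const n 0ℚ
  expect-sumℚ n (suc m) F =
    trans (expect-+ n (F zero) (λ ω → sumℚ m (λ u → F (suc u) ω)))
          (cong (expect μ n (F zero) +_) (expect-sumℚ n m (λ u → F (suc u))))

  expect-someSuccess : ∀ n (P : Fin n → Bool) →
    expect μ n (λ ω → if anyFin n (λ t → P t ∧ ω t) then 1ℚ else 0ℚ)
      ≡ 1ℚ - (1ℚ - μ) ^ sumℕ n (λ t → if P t then 1 else 0)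
  expect-someSuccess zero    P = solve 0 (con 0ℚ := con 1ℚ :- con 1ℚ) refl
  expect-someSuccess (suc n) P with P zero
  ... | true  rewrite expect-const n 1ℚ | expect-someSuccess n (λ t → P (suc t)) =
    solve 2 (λ μ q → μ :* con 1ℚ :+ (con 1ℚ :- μ) :* (con 1ℚ :- q) := con 1ℚ :- (con 1ℚ :- μ) :* q)
      refl μ _
  ... | false rewrite expect-someSuccess n (λ t → P (suc t)) = mixture-of-equal _

*-nonNeg : ∀ {p q} → 0ℚ ≤ p → 0ℚ ≤ q → 0ℚ ≤ p * q
*-nonNeg {p} {q} 0≤p 0≤q = ℚP.nonNegative⁻¹ (p * q)
  {{ℚP.nonNeg*nonNeg⇒nonNeg p {{nonNegative 0≤p}} q {{nonNegative 0≤q}}}}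

*-monoˡ-≤-0≤ : ∀ {c p q} → 0ℚ ≤ c → p ≤ q → c * p ≤ c * q
*-monoˡ-≤-0≤ {c} 0≤c = ℚP.*-monoˡ-≤-nonNeg c {{nonNegative 0≤c}}

p≤q⇒0≤q-p : ∀ {p q} → p ≤ q → 0ℚ ≤ q - p
p≤q⇒0≤q-p {p} p≤q = ℚP.≤-trans (ℚP.≤-reflexive (sym (ℚP.+-inverseʳ p))) (ℚP.+-monoˡ-≤ (- p) p≤q)

^-nonNeg : ∀ {r} → 0ℚ ≤ r → ∀ n → 0ℚ ≤ r ^ n
^-nonNeg 0≤r zero    = ℚP.nonNegative⁻¹ 1ℚ
^-nonNeg 0≤r (suc n) = *-nonNeg 0≤r (^-nonNeg 0≤r n)

module _ {r : ℚ} (0≤r : 0ℚ ≤ r) (r≤1 : r ≤ 1ℚ) where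

  ^-≤1 : ∀ n → r ^ n ≤ 1ℚ
  ^-≤1 zero    = ℚP.≤-refl
  ^-≤1 (suc n) = ℚP.≤-trans (*-monoˡ-≤-0≤ 0≤r (^-≤1 n)) (ℚP.≤-trans (ℚP.≤-reflexive (ℚP.*-identityʳ r)) r≤1)

  ^-antimonoʳ-≤ : ∀ {c n} → c ℕ.≤ n → r ^ n ≤ r ^ c
  ^-antimonoʳ-≤ {n = n} ℕ.z≤n = ^-≤1 n
  ^-antimonoʳ-≤ (ℕ.s≤s c≤n)    = *-monoˡ-≤-0≤ 0≤r (^-antimonoʳ-≤ c≤n)

telescope : ∀ n (f : ℕ → ℚ) (d : Fin n → ℚ) →
  (∀ k → f (suc (toℕ k)) ≡ f (toℕ k) + d k) → f n ≡ f 0 + sumℚ n d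
telescope zero    f d step = sym (ℚP.+-identityʳ (f 0))
telescope (suc n) f d step = begin
  f (suc n)                                  ≡⟨ telescope n (λ i → f (suc i)) (λ k → d (suc k)) (λ k → step (suc k)) ⟩
  f 1 + sumℚ n (λ k → d (suc k))             ≡⟨ cong (_+ sumℚ n (λ k → d (suc k))) (step zero) ⟩
  (f 0 + d zero) + sumℚ n (λ k → d (suc k))  ≡⟨ ℚP.+-assoc (f 0) (d zero) _ ⟩
  f 0 + sumℚ (suc n) d                       ∎
  where open ≡-Reasoning

toℕ<ᵇn : ∀ {n} (j : Fin n) → (toℕ j <ᵇ n) ≡ true
toℕ<ᵇn zero    = refl
toℕ<ᵇn (suc j) = toℕ<ᵇn j

indicator-∧-≤ : ∀ b c → (if b ∧ c then 1 else 0) ℕ.≤ (if c then 1 else 0)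
indicator-∧-≤ true  c     = ℕP.≤-refl
indicator-∧-≤ false true  = ℕ.z≤n
indicator-∧-≤ false false = ℕ.z≤n

<ᵇ-suc-indicator : ∀ {n} (j k : Fin n) (b : Bool) →
  (if (toℕ j <ᵇ suc (toℕ k)) ∧ b then 1 else 0)
    ≡ (if ⌊ k ≟ j ⌋ then (if b then 1 else 0) else 0) ℕ.+ (if (toℕ j <ᵇ toℕ k) ∧ b then 1 else 0)
<ᵇ-suc-indicator zero    zero    b = sym (ℕP.+-identityʳ _)
<ᵇ-suc-indicator zero    (suc k) b = refl
<ᵇ-suc-indicator (suc j) zero    b = refl
<ᵇ-suc-indicator (suc j) (suc k) b rewrite ⌊suc≟suc⌋ k j = <ᵇ-suc-indicator j k b

module GreedyDExpectation (I : Instance) (σ : Fin (Instance.T I) → Fin (Instance.T I))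
                          (a : Fin (Instance.T I) → Fin (Instance.m I)) where
  open Instance I
  open BernoulliExpectation μ

  countBefore : ℕ → Fin m → ℕ
  countBefore K u = sumℕ T (λ j → if (toℕ j <ᵇ K) ∧ ⌊ a (σ j) ≟ u ⌋ then 1 else 0)

  countBefore-suc : ∀ k u →
    countBefore (suc (toℕ k)) u ≡ (if ⌊ a (σ k) ≟ u ⌋ then 1 else 0) ℕ.+ countBefore (toℕ k) u
  countBefore-suc k u = begin
    countBefore (suc (toℕ k)) u
      ≡⟨ sumℕ-cong T (λ j → <ᵇ-suc-indicator j k (matchedTo j)) ⟩
    sumℕ T (λ j → (if ⌊ k ≟ j ⌋ then indicator j else 0) ℕ.+ (if (toℕ j <ᵇ toℕ k) ∧ matchedTo j then 1 else 0))
      ≡⟨ sumℕ-distrib-+ T _ _ ⟩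
    sumℕ T (λ j → if ⌊ k ≟ j ⌋ then indicator j else 0) ℕ.+ countBefore (toℕ k) u
      ≡⟨ cong (ℕ._+ countBefore (toℕ k) u) (sumℕ-δ T k indicator) ⟩
    indicator k ℕ.+ countBefore (toℕ k) u ∎
    where
    open ≡-Reasoning
    matchedTo : Fin T → Bool
    matchedTo j = ⌊ a (σ j) ≟ u ⌋
    indicator : Fin T → ℕ
    indicator j = if matchedTo j then 1 else 0

  sumℕ-matches≡countBefore-T : ArrivalSeq I σ → ∀ u →
    sumℕ T (λ t → if ⌊ a t ≟ u ⌋ then 1 else 0) ≡ countBefore T u
  sumℕ-matches≡countBefore-T σ-bij u = trans (sumℕ-permute T σ-bij _)
    (sumℕ-cong T (λ j → cong (λ b → if b ∧ ⌊ a (σ j) ≟ u ⌋ then 1 else 0) (sym (toℕ<ᵇn j))))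

  r : ℚ
  r = 1ℚ - μ

  expectedConsumedBefore : ℕ → ℚ
  expectedConsumedBefore K = sumℚ m (λ u → 1ℚ - r ^ countBefore K u)

  expectedValue≡expectedConsumedBefore-T : ArrivalSeq I σ → expectedValue I a ≡ expectedConsumedBefore T
  expectedValue≡expectedConsumedBefore-T σ-bij = begin
    expect μ T (consumed I a)
      ≡⟨ expect-sumℚ T m _ ⟩
    sumℚ m (λ u → expect μ T (λ ω → if anyFin T (λ t → ⌊ a t ≟ u ⌋ ∧ ω t) then 1ℚ else 0ℚ))
      ≡⟨ sumℚ-cong m (λ u → expect-someSuccess T (λ t → ⌊ a t ≟ u ⌋)) ⟩
    sumℚ m (λ u → 1ℚ - r ^ sumℕ T (λ t → if ⌊ a t ≟ u ⌋ then 1 else 0))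
      ≡⟨ sumℚ-cong m (λ u → cong (λ c → 1ℚ - r ^ c) (sumℕ-matches≡countBefore-T σ-bij u)) ⟩
    expectedConsumedBefore T ∎
    where open ≡-Reasoning

  expectedConsumedBefore-zero : expectedConsumedBefore 0 ≡ 0ℚ
  expectedConsumedBefore-zero = trans
    (sumℚ-cong m (λ u → trans (cong (λ c → 1ℚ - r ^ c) (sumℕ-zero T)) (ℚP.+-inverseʳ 1ℚ)))
    (sumℚ-zero m)

  expectedConsumptionAt : Fin T → ℚ
  expectedConsumptionAt k = μ * r ^ countBefore (toℕ k) (a (σ k))

  expectedConsumedBefore-suc : ∀ k →
    expectedConsumedBefore (suc (toℕ k)) ≡ expectedConsumedBefore (toℕ k) + expectedConsumptionAt k
  expectedConsumedBefore-suc k = begin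
    expectedConsumedBefore (suc K)
      ≡⟨ sumℚ-cong m (λ u → trans (cong (λ c → 1ℚ - r ^ c) (countBefore-suc k u)) (step u)) ⟩
    sumℚ m (λ u → (1ℚ - r ^ countBefore K u) + (if ⌊ v ≟ u ⌋ then μ * r ^ countBefore K u else 0ℚ))
      ≡⟨ sumℚ-distrib-+ m _ _ ⟩
    expectedConsumedBefore K + sumℚ m (λ u → if ⌊ v ≟ u ⌋ then μ * r ^ countBefore K u else 0ℚ)
      ≡⟨ cong (expectedConsumedBefore K +_) (sumℚ-δ m v (λ u → μ * r ^ countBefore K u)) ⟩
    expectedConsumedBefore K + μ * r ^ countBefore K v ∎
    where
    open ≡-Reasoning
    open +-*-Solver
    K = toℕ k
    v = a (σ k)
    step : ∀ u → 1ℚ - r ^ ((if ⌊ v ≟ u ⌋ then 1 else 0) ℕ.+ countBefore K u)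
               ≡ (1ℚ - r ^ countBefore K u) + (if ⌊ v ≟ u ⌋ then μ * r ^ countBefore K u else 0ℚ)
    step u with ⌊ v ≟ u ⌋
    ... | true  = solve 2 (λ μ q → con 1ℚ :- (con 1ℚ :- μ) :* q := (con 1ℚ :- q) :+ μ :* q)
                    refl μ (r ^ countBefore K u)
    ... | false = sym (ℚP.+-identityʳ _)

  expectedValue-by-period : ArrivalSeq I σ → expectedValue I a ≡ sumℚ T expectedConsumptionAt
  expectedValue-by-period σ-bij = begin
    expectedValue I a                                         ≡⟨ expectedValue≡expectedConsumedBefore-T σ-bij ⟩
    expectedConsumedBefore T                                  ≡⟨ telescope T expectedConsumedBefore _ expectedConsumedBefore-suc ⟩
    expectedConsumedBefore 0 + sumℚ T expectedConsumptionAt  ≡⟨ cong (_+ sumℚ T expectedConsumptionAt) expectedConsumedBefore-zero ⟩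
    0ℚ + sumℚ T expectedConsumptionAt                         ≡⟨ ℚP.+-identityˡ _ ⟩
    sumℚ T expectedConsumptionAt                              ∎
    where open ≡-Reasoning

module GreedyDVersusLP (I : Instance) (σ : Fin (Instance.T I) → Fin (Instance.T I))
                       (a : Fin (Instance.T I) → Fin (Instance.m I))
                       (σ-bij : ArrivalSeq I σ) (greedy : GreedyDRun I σ a) where
  open Instance I
  open GreedyDExpectation I σ a
  open +-*-Solver

  0≤μ : 0ℚ ≤ μ
  0≤μ = ℚP.<⇒≤ μ-pos

  0≤r : 0ℚ ≤ r
  0≤r = p≤q⇒0≤q-p μ-le1

  r≤1 : r ≤ 1ℚ
  r≤1 = ℚP.≤-trans (ℚP.+-monoʳ-≤ 1ℚ (ℚP.neg-antimono-≤ 0≤μ)) (ℚP.≤-reflexive (ℚP.+-identityʳ 1ℚ))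

  survival : Fin m → ℚ
  survival u = r ^ countBefore T u

  survivalAt : Fin T → ℚ
  survivalAt k = r ^ countBefore (toℕ k) (a (σ k))

  countBefore-≤-T : ∀ (k : Fin T) u → countBefore (toℕ k) u ℕ.≤ countBefore T u
  countBefore-≤-T k u = sumℕ-mono-≤ T (λ j → ℕP.≤-trans (indicator-∧-≤ _ _)
    (ℕP.≤-reflexive (cong (λ b → if b ∧ ⌊ a (σ j) ≟ u ⌋ then 1 else 0) (sym (toℕ<ᵇn j)))))

  -- The greedy choice: every neighbour of σ k had a counter at least that of a (σ k) at period k.
  survival≤survivalAt : ∀ k u → edge u (σ k) ≡ true → survival u ≤ survivalAt k
  survival≤survivalAt k u u~σk =
    ^-antimonoʳ-≤ 0≤r r≤1 (ℕP.≤-trans (proj₂ (greedy k) u u~σk) (countBefore-≤-T k u))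

  load : (Fin m → Fin T → ℚ) → Fin m → ℚ
  load x u = sumℚ T (λ t → if edge u t then μ * x u t else 0ℚ)

  survival-weighted-load-≤ : ∀ x → (∀ u t → 0ℚ ≤ x u t) →
    (∀ t → sumℚ m (λ u → if edge u t then x u t else 0ℚ) ≤ 1ℚ) →
    sumℚ m (λ u → survival u * load x u) ≤ expectedValue I a
  survival-weighted-load-≤ x x≥0 demand≤1 = begin
    sumℚ m (λ u → survival u * load x u)
      ≡⟨ sumℚ-cong m (λ u → *-distribˡ-sumℚ T (survival u) _) ⟩
    sumℚ m (λ u → sumℚ T (λ t → survival u * y u t))
      ≡⟨ sumℚ-comm m T _ ⟩
    sumℚ T (λ t → sumℚ m (λ u → survival u * y u t))
      ≡⟨ sumℚ-permute T σ-bij _ ⟩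
    sumℚ T (λ k → sumℚ m (λ u → survival u * y u (σ k)))
      ≤⟨ sumℚ-mono-≤ T period-≤ ⟩
    sumℚ T expectedConsumptionAt
      ≡⟨ expectedValue-by-period σ-bij ⟨
    expectedValue I a ∎
    where
    open ℚP.≤-Reasoning
    y : Fin m → Fin T → ℚ
    y u t = if edge u t then μ * x u t else 0ℚ

    term-≤ : ∀ k u → survival u * y u (σ k) ≤ expectedConsumptionAt k * (if edge u (σ k) then x u (σ k) else 0ℚ)
    term-≤ k u with edge u (σ k) in u~σk
    ... | true  = begin
      survival u * (μ * x u (σ k))    ≡⟨ ℚP.*-comm (survival u) _ ⟩
      (μ * x u (σ k)) * survival u    ≤⟨ *-monoˡ-≤-0≤ (*-nonNeg 0≤μ (x≥0 u (σ k))) (survival≤survivalAt k u u~σk) ⟩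
      (μ * x u (σ k)) * survivalAt k  ≡⟨ solve 3 (λ μ x p → (μ :* x) :* p := (μ :* p) :* x) refl μ (x u (σ k)) (survivalAt k) ⟩
      expectedConsumptionAt k * x u (σ k) ∎
    ... | false = ℚP.≤-reflexive (trans (ℚP.*-zeroʳ (survival u)) (sym (ℚP.*-zeroʳ (expectedConsumptionAt k))))

    period-≤ : ∀ k → sumℚ m (λ u → survival u * y u (σ k)) ≤ expectedConsumptionAt k
    period-≤ k = begin
      sumℚ m (λ u → survival u * y u (σ k))
        ≤⟨ sumℚ-mono-≤ m (term-≤ k) ⟩
      sumℚ m (λ u → expectedConsumptionAt k * (if edge u (σ k) then x u (σ k) else 0ℚ))
        ≡⟨ *-distribˡ-sumℚ m (expectedConsumptionAt k) _ ⟨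
      expectedConsumptionAt k * sumℚ m (λ u → if edge u (σ k) then x u (σ k) else 0ℚ)
        ≤⟨ *-monoˡ-≤-0≤ (*-nonNeg 0≤μ (^-nonNeg 0≤r (countBefore (toℕ k) (a (σ k))))) (demand≤1 (σ k)) ⟩
      expectedConsumptionAt k * 1ℚ
        ≡⟨ ℚP.*-identityʳ _ ⟩
      expectedConsumptionAt k ∎

  consumption-weighted-load-≤ : ∀ κ x → (∀ u → load x u ≤ κ) →
    sumℚ m (λ u → (1ℚ - survival u) * load x u) ≤ expectedValue I a * κ
  consumption-weighted-load-≤ κ x load≤κ = begin
    sumℚ m (λ u → (1ℚ - survival u) * load x u)
      ≤⟨ sumℚ-mono-≤ m (λ u → *-monoˡ-≤-0≤ (p≤q⇒0≤q-p (^-≤1 0≤r r≤1 (countBefore T u))) (load≤κ u)) ⟩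
    sumℚ m (λ u → (1ℚ - survival u) * κ)
      ≡⟨ sumℚ-cong m (λ u → ℚP.*-comm _ κ) ⟩
    sumℚ m (λ u → κ * (1ℚ - survival u))
      ≡⟨ *-distribˡ-sumℚ m κ _ ⟨
    κ * expectedConsumedBefore T
      ≡⟨ ℚP.*-comm κ _ ⟩
    expectedConsumedBefore T * κ
      ≡⟨ cong (_* κ) (expectedValue≡expectedConsumedBefore-T σ-bij) ⟨
    expectedValue I a * κ ∎
    where open ℚP.≤-Reasoning

  LPObj-≤-expectedValue : ∀ κ x → LPFeasible I κ x → LPObj I x ≤ expectedValue I a * (1ℚ + κ)
  LPObj-≤-expectedValue κ x (x≥0 , load≤κ , demand≤1) = begin
    LPObj I x
      ≡⟨ sumℚ-cong m (λ u → solve 2 (λ s l → l := s :* l :+ (con 1ℚ :- s) :* l) refl (survival u) (load x u)) ⟩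
    sumℚ m (λ u → survival u * load x u + (1ℚ - survival u) * load x u)
      ≡⟨ sumℚ-distrib-+ m _ _ ⟩
    sumℚ m (λ u → survival u * load x u) + sumℚ m (λ u → (1ℚ - survival u) * load x u)
      ≤⟨ ℚP.+-mono-≤ (survival-weighted-load-≤ x x≥0 demand≤1) (consumption-weighted-load-≤ κ x load≤κ) ⟩
    expectedValue I a + expectedValue I a * κ
      ≡⟨ solve 2 (λ e k → e :+ e :* k := e :* (con 1ℚ :+ k)) refl (expectedValue I a) κ ⟩
    expectedValue I a * (1ℚ + κ) ∎
    where open ℚP.≤-Reasoning

  OFF-I-≤-expectedValue : ∀ κ v → IsOFF-I I κ v → v ≤ expectedValue I a * (1ℚ + κ)
  OFF-I-≤-expectedValue κ v ((x , x-feasible , x≡v) , _) =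
    subst (_≤ _) x≡v (LPObj-≤-expectedValue κ x x-feasible)

IsOFF-I-unique : ∀ I {κ v w} → IsOFF-I I κ v → IsOFF-I I κ w → v ≡ w
IsOFF-I-unique I ((x , x-feasible , x≡v) , v-optimal) ((y , y-feasible , y≡w) , w-optimal) =
  ℚP.≤-antisym (subst (_≤ _) x≡v (w-optimal x x-feasible)) (subst (_≤ _) y≡w (v-optimal y y-feasible))

proposition3 : (I : Instance) (σ : Fin (Instance.T I) → Fin (Instance.T I)) →
    ArrivalSeq I σ →
    (a : Fin (Instance.T I) → Fin (Instance.m I)) → GreedyDRun I σ a →
    (off : ℚ) → IsOFF-I I 1ℚ off →
    ((κ : ℚ) → Oversupplied I κ → off ≤ expectedValue I a * (1ℚ + κ))
    × ((κ : ℚ) → Undersupplied I κ → κ * off ≤ expectedValue I a * (1ℚ + κ))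
proposition3 I σ σ-bij a greedy off off-optimal = oversupplied , undersupplied
  where
  open GreedyDVersusLP I σ a σ-bij greedy using (OFF-I-≤-expectedValue)

  oversupplied : (κ : ℚ) → Oversupplied I κ → off ≤ expectedValue I a * (1ℚ + κ)
  oversupplied κ (_ , (v , v-optimal , OFF-κ≡v) , _) =
    subst (_≤ _) (IsOFF-I-unique I v-optimal off-optimal) (OFF-I-≤-expectedValue κ v OFF-κ≡v)

  undersupplied : (κ : ℚ) → Undersupplied I κ → κ * off ≤ expectedValue I a * (1ℚ + κ)
  undersupplied κ (_ , (v , v-optimal , OFF-κ≡κv) , _) =
    subst (λ w → κ * w ≤ _) (IsOFF-I-unique I v-optimal off-optimal) (OFF-I-≤-expectedValue κ (κ * v) OFF-κ≡κv)
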